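{- Let $k,t$ be integers with $1\leq k\leq t$ and let $d=\binom{2t-2k}{t-k}$. Then $$bc_d(KG(2t,k))=bp_d(KG(2t,k))=\frac{1}{2}\binom{2t}{t}.$$
   Context: The Kneser graph $KG(n,r)$ has as vertices all $r$-subsets of an $n$-element set, two vertices adjacent iff the subsets are disjoint. A biclique of a graph is a complete bipartite subgraph. $bc_d(G)$ is the smallest number of bicliques of $G$ such that every edge of $G$ belongs to at least $d$ of them; $bp_d(G)$ is the smallest number of bicliques of $G$ such that every edge of $G$ belongs to exactly $d$ of them. -}

module Defs where

open import Data.Nat using (ℕ; zero; suc; _≤_; _+_)
open import Data.Bool using (Bool; true; false; _∧_; _∨_; if_then_else_)
open import Data.List using (List; []; _∷_; length)
open import Data.Fin using (Fin)
open import Data.Fin.Subset using (Subset; _∈_; _∉_; ∣_∣)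
open import Data.Product using (Σ; ∃; _×_; _,_)
open import Relation.Binary.PropositionalEquality using (_≡_)

record Graph : Set₁ where
  field
    V   : Set
    Adj : V → V → Set
open Graph public

KG : ℕ → ℕ → Graph
KG n r = record
  { V   = Σ (Subset n) (λ s → ∣ s ∣ ≡ r)
  ; Adj = λ u v → ∀ (i : Fin n) → i ∈ Σ.proj₁ u → i ∉ Σ.proj₁ v
  }
  where open import Data.Product using (module Σ)

record Biclique (G : Graph) : Set where
  field
    A B       : V G → Bool
    A-nonempty : ∃ λ a → A a ≡ true
    B-nonempty : ∃ λ b → B b ≡ true
    disjoint   : ∀ v → A v ≡ true → B v ≡ false
    complete   : ∀ a b → A a ≡ true → B b ≡ true → Adj G a b
open Biclique public

contains : {G : Graph} → Biclique G → V G → V G → Bool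
contains β u v = (A β u ∧ B β v) ∨ (A β v ∧ B β u)

-- Number of bicliques of a family (a list, repetitions allowed) containing edge {u,v}.
mult : {G : Graph} → List (Biclique G) → V G → V G → ℕ
mult [] u v = 0
mult (β ∷ βs) u v = (if contains β u v then 1 else 0) + mult βs u v

IsBicliqueCover : (G : Graph) → ℕ → List (Biclique G) → Set
IsBicliqueCover G d F = ∀ u v → Adj G u v → d ≤ mult F u v

IsBicliquePartition : (G : Graph) → ℕ → List (Biclique G) → Set
IsBicliquePartition G d F = ∀ u v → Adj G u v → mult F u v ≡ d

bc-is : (G : Graph) → ℕ → ℕ → Set
bc-is G d m =
  (Σ (List (Biclique G)) λ F → IsBicliqueCover G d F × length F ≡ m) ×
  (∀ (F : List (Biclique G)) → IsBicliqueCover G d F → m ≤ length F)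

bp-is : (G : Graph) → ℕ → ℕ → Set
bp-is G d m =
  (Σ (List (Biclique G)) λ F → IsBicliquePartition G d F × length F ≡ m) ×
  (∀ (F : List (Biclique G)) → IsBicliquePartition G d F → m ≤ length F)

-- Lower bound: there are C(2t, k) C(2t − k, k) ordered pairs of disjoint k-sets, each lying in at least d
-- bicliques. The two sides of a biclique consist of k-subsets of disjoint sets X and Y, so it contains
-- at most 2 C(|X|, k) C(|Y|, k) ≤ 2 C(t, k)² ordered pairs, and the identity
-- C(2t, k) C(2t − k, k) C(2t − 2k, t − k) = C(2t, t) C(t, k)² gives at least C(2t, t) / 2 bicliques.
-- Upper bound: fix a point 0; every t-set S ∋ 0 gives the biclique between the k-subsets of S and those of
-- its complement, C(2t − 1, t − 1) = C(2t, t) / 2 bicliques in all. The edge {u, v} lies in the biclique of S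
-- iff u ⊆ S ⊆ ∁ v or v ⊆ S ⊆ ∁ u. If 0 ∈ u only the first is possible, for C(2t − 2k, t − k) sets S; if
-- 0 ∉ u ∪ v each is possible for C(2t − 2k − 1, t − k − 1) sets, and twice that is again C(2t − 2k, t − k).

module Submission where

open import Defs
open import Data.Bool using (Bool; true; false; _∧_; _∨_; not; if_then_else_; T)
open import Data.Bool.Properties using (∧-conicalˡ; ∧-conicalʳ; ∧-zeroʳ; ∨-comm; ∨-identityʳ)
open import Data.Fin using (zero; suc)
open import Data.Fin.Subset using (Subset; ∣_∣; ⊥; ⊤; ∁; _∪_; _∈_; _∉_)
open import Data.Fin.Subset.Properties using (∣⊥∣≡0; ∣⊤∣≡n; ∣∁p∣≡n∸∣p∣; ∣p∣≤n)
open import Data.List using (List; []; _∷_; _++_; map; length)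
open import Data.List.Properties using (length-map)
open import Data.Nat
open import Data.Nat.Properties
open import Algebra.Properties.CommutativeSemigroup +-commutativeSemigroup using () renaming (interchange to +-interchange)
open import Data.Nat.Combinatorics
  using (_C_; nCk≡n!/k![n-k]!; k![n∸k]!∣n!; nCk+nC[k+1]≡[n+1]C[k+1]; nCk≡nC[n∸k]; k>n⇒nCk≡0)
open import Data.Nat.DivMod using (_/_; m/n*n≡m; m*n/n≡m)
open import Data.Nat.Tactic.RingSolver using (solve-∀)
open import Data.Product using (Σ; _×_; _,_; proj₁)
open import Data.Sum using ([_,_]′)
open import Data.Unit using (tt)
open import Data.Vec using (_∷_; []; here; there)
open import Relation.Binary.PropositionalEquality
open import Relation.Nullary using (yes; no; contradiction)


-- Binomial coefficients

C*!*!≡! : ∀ k r → ((k + r) C k) * (k ! * r !) ≡ (k + r) !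
C*!*!≡! k r = begin
  ((k + r) C k) * (k ! * r !)           ≡⟨ cong (λ x → ((k + r) C k) * (k ! * x !)) (sym (m+n∸m≡n k r)) ⟩
  ((k + r) C k) * (k ! * (k + r ∸ k) !) ≡⟨ cong (_* (k ! * (k + r ∸ k) !)) (nCk≡n!/k![n-k]! k≤k+r) ⟩
  _                                   ≡⟨ m/n*n≡m {{k !* (k + r ∸ k) !≢0}} (k![n∸k]!∣n! k≤k+r) ⟩
  (k + r) ! ∎
  where
  open ≡-Reasoning
  k≤k+r : k ≤ k + r
  k≤k+r = m≤m+n k r

C-pos : ∀ k r → 0 < (k + r) C k
C-pos k r = >-nonZero⁻¹ _ {{m*n≢0⇒m≢0 _ {{subst NonZero (sym (C*!*!≡! k r)) ((k + r) !≢0)}}}}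

C-monoˡ-≤ : ∀ {m n} k → m ≤ n → m C k ≤ n C k
C-monoˡ-≤ {m} k m≤n with m≤n⇒∃[o]m+o≡n m≤n
... | o , refl = mCk≤[m+o]Ck o
  where
  nCk≤[n+1]Ck : ∀ n k → n C k ≤ suc n C k
  nCk≤[n+1]Ck n zero    = ≤-refl
  nCk≤[n+1]Ck n (suc k) = subst (n C suc k ≤_) (nCk+nC[k+1]≡[n+1]C[k+1] n k) (m≤n+m _ _)
  mCk≤[m+o]Ck : ∀ o → m C k ≤ (m + o) C k
  mCk≤[m+o]Ck zero    = ≤-reflexive (cong (_C k) (sym (+-identityʳ m)))
  mCk≤[m+o]Ck (suc o) = ≤-trans (mCk≤[m+o]Ck o)
    (subst (((m + o) C k) ≤_) (cong (_C k) (sym (+-suc m o))) (nCk≤[n+1]Ck (m + o) k))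

[n+1]*nCk≡[r+1]*[n+1]Ck : ∀ {k n r} → k + r ≡ n → suc n * (n C k) ≡ suc r * (suc n C k)
[n+1]*nCk≡[r+1]*[n+1]Ck {k} {r = r} refl = *-cancelʳ-≡ _ _ (k ! * r !) {{k !* r !≢0}} (begin
  suc (k + r) * ((k + r) C k) * (k ! * r !)     ≡⟨ *-assoc (suc (k + r)) ((k + r) C k) (k ! * r !) ⟩
  suc (k + r) * (((k + r) C k) * (k ! * r !))   ≡⟨ cong (suc (k + r) *_) (C*!*!≡! k r) ⟩
  suc (k + r) !                                 ≡⟨ cong _! (sym (+-suc k r)) ⟩
  (k + suc r) !                                 ≡⟨ sym (C*!*!≡! k (suc r)) ⟩
  ((k + suc r) C k) * (k ! * (suc r * r !))     ≡⟨ cong (λ x → (x C k) * (k ! * (suc r * r !))) (+-suc k r) ⟩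
  (suc (k + r) C k) * (k ! * (suc r * r !))     ≡⟨ regroup (suc (k + r) C k) (k !) (suc r) (r !) ⟩
  suc r * (suc (k + r) C k) * (k ! * r !)       ∎)
  where
  open ≡-Reasoning
  regroup : ∀ c x s y → c * (x * (s * y)) ≡ s * c * (x * y)
  regroup = solve-∀

-- C(n + 1, k) / C(n, k) = (n + 1) / (n + 1 − k) decreases in n.
aCk*[b+1]Ck≤[a+1]Ck*bCk : ∀ {k a b} → k ≤ a → a ≤ b → (a C k) * (suc b C k) ≤ (suc a C k) * (b C k)
aCk*[b+1]Ck≤[a+1]Ck*bCk {k} k≤a a≤b with m≤n⇒∃[o]m+o≡n k≤a | m≤n⇒∃[o]m+o≡n a≤b
... | p , refl | q , refl = *-cancelʳ-≤ _ _ (suc a * suc (p + q)) (begin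
  A₁ * B₂ * (suc a * suc (p + q))         ≡⟨ spread A₁ B₂ (suc a) (suc (p + q)) ⟩
  (suc a * A₁) * (suc (p + q) * B₂)       ≡⟨ cong₂ _*_ ([n+1]*nCk≡[r+1]*[n+1]Ck {k} {r = p} refl)
                                                       (sym ([n+1]*nCk≡[r+1]*[n+1]Ck {k} {r = p + q} (sym (+-assoc k p q)))) ⟩
  (suc p * A₂) * (suc b * B₁)             ≡⟨ gather A₂ B₁ (suc p) (suc b) ⟩
  (suc p * suc b) * (A₂ * B₁)             ≤⟨ *-monoˡ-≤ (A₂ * B₁) weights ⟩
  (suc a * suc (p + q)) * (A₂ * B₁)       ≡⟨ *-comm (suc a * suc (p + q)) (A₂ * B₁) ⟩
  A₂ * B₁ * (suc a * suc (p + q))         ∎)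
  where
  open ≤-Reasoning
  a b A₁ A₂ B₁ B₂ : ℕ
  a = k + p
  b = k + p + q
  A₁ = a C k
  A₂ = suc a C k
  B₁ = b C k
  B₂ = suc b C k
  spread : ∀ x y u v → x * y * (u * v) ≡ (u * x) * (v * y)
  spread = solve-∀
  gather : ∀ x y u v → (u * x) * (v * y) ≡ (u * v) * (x * y)
  gather = solve-∀
  expandˡ : ∀ k p q → suc p * suc (k + p + q) ≡ suc p * suc (p + q) + k * suc p
  expandˡ = solve-∀
  expandʳ : ∀ k p q → suc (k + p) * suc (p + q) ≡ suc p * suc (p + q) + k * suc (p + q)
  expandʳ = solve-∀
  weights : suc p * suc b ≤ suc a * suc (p + q)
  weights = subst₂ _≤_ (sym (expandˡ k p q)) (sym (expandʳ k p q))
    (+-monoʳ-≤ (suc p * suc (p + q)) (*-monoʳ-≤ k (s≤s (m≤m+n p q))))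

xCk*yCk≤tCk*tCk : ∀ t k x y → x + y ≤ t + t → (x C k) * (y C k) ≤ (t C k) * (t C k)
xCk*yCk≤tCk*tCk t k x y x+y≤2t =
  [ (λ x≤y → ordered x y x≤y x+y≤2t)
  , (λ y≤x → subst (_≤ (t C k) * (t C k)) (*-comm (y C k) (x C k))
                (ordered y x y≤x (subst (_≤ t + t) (+-comm x y) x+y≤2t)))
  ]′ (≤-total x y)
  where
  ordered : ∀ x y → x ≤ y → x + y ≤ t + t → (x C k) * (y C k) ≤ (t C k) * (t C k)
  ordered x y x≤y x+y≤2t with y ≤? t
  ... | yes y≤t = *-mono-≤ (C-monoˡ-≤ k (≤-trans x≤y y≤t)) (C-monoˡ-≤ k y≤t)
  ordered x zero    x≤y x+y≤2t | no y≰t = contradiction z≤n y≰t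
  ordered x (suc y) x≤y x+y≤2t | no y≰t with k ≤? x
  ... | no k≰x = subst (λ c → c * (suc y C k) ≤ (t C k) * (t C k)) (sym (k>n⇒nCk≡0 (≰⇒> k≰x))) z≤n
  ... | yes k≤x = ≤-trans (aCk*[b+1]Ck≤[a+1]Ck*bCk k≤x (≤-trans (n≤1+n x) sx≤y)) (ordered (suc x) y sx≤y sx+y≤2t)
    where
    t≤y : t ≤ y
    t≤y = ≤-pred (≰⇒> y≰t)
    sx+y≤2t : suc x + y ≤ t + t
    sx+y≤2t = subst (_≤ t + t) (+-suc x y) x+y≤2t
    sx≤t : suc x ≤ t
    sx≤t = +-cancelʳ-≤ t (suc x) t (≤-trans (+-monoʳ-≤ (suc x) t≤y) sx+y≤2t)
    sx≤y : suc x ≤ y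
    sx≤y = ≤-trans sx≤t t≤y

[2m+2]C[m+1]≡2*[2m+1]Cm : ∀ m → (suc m + suc m) C suc m ≡ 2 * ((m + suc m) C m)
[2m+2]C[m+1]≡2*[2m+1]Cm m = begin
  suc n C suc m       ≡⟨ sym (nCk+nC[k+1]≡[n+1]C[k+1] n m) ⟩
  n C m + n C suc m   ≡⟨ cong (n C m +_) (nCk≡nC[n∸k] (m≤n+m (suc m) m)) ⟩
  n C m + n C (n ∸ suc m) ≡⟨ cong (λ x → n C m + n C x) (m+n∸n≡m m (suc m)) ⟩
  n C m + n C m       ≡⟨ cong (n C m +_) (sym (+-identityʳ (n C m))) ⟩
  2 * (n C m)         ∎
  where
  open ≡-Reasoning
  n : ℕ
  n = m + suc m

-- Both sides count the ways to split 2(k + m) points into blocks of sizes k, k, m, m.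
C-multinomial : ∀ k m →
  ((k + (k + (m + m))) C k) * ((k + (m + m)) C k) * ((m + m) C m) ≡
  (((k + m) + (k + m)) C (k + m)) * (((k + m) C k) * ((k + m) C k))
C-multinomial k m = *-cancelʳ-≡ _ _ (k ! * k ! * (m ! * m !)) {{ denominator≢0 }} (trans lhs (sym rhs))
  where
  open ≡-Reasoning
  t : ℕ
  t = k + m
  denominator≢0 : NonZero (k ! * k ! * (m ! * m !))
  denominator≢0 = m*n≢0 _ _ {{k !* k !≢0}} {{m !* m !≢0}}
  C₁ C₂ C₃ D : ℕ
  C₁ = (k + (k + (m + m))) C k
  C₂ = (k + (m + m)) C k
  C₃ = (m + m) C m
  D  = t C k
  regroupˡ : ∀ a b c x y u v → a * b * c * (x * y * (u * v)) ≡ a * (x * (b * (y * (c * (u * v)))))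
  regroupˡ = solve-∀
  regroupʳ : ∀ a d x y u v → a * (d * d) * (x * y * (u * v)) ≡ a * ((d * (x * u)) * (d * (y * v)))
  regroupʳ = solve-∀
  reassoc : ∀ k m → k + (k + (m + m)) ≡ (k + m) + (k + m)
  reassoc = solve-∀
  lhs : C₁ * C₂ * C₃ * (k ! * k ! * (m ! * m !)) ≡ (t + t) !
  lhs = begin
    C₁ * C₂ * C₃ * (k ! * k ! * (m ! * m !))         ≡⟨ regroupˡ C₁ C₂ C₃ (k !) (k !) (m !) (m !) ⟩
    C₁ * (k ! * (C₂ * (k ! * (C₃ * (m ! * m !)))))   ≡⟨ cong (λ x → C₁ * (k ! * (C₂ * (k ! * x)))) (C*!*!≡! m m) ⟩
    C₁ * (k ! * (C₂ * (k ! * (m + m) !)))            ≡⟨ cong (λ x → C₁ * (k ! * x)) (C*!*!≡! k (m + m)) ⟩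
    C₁ * (k ! * (k + (m + m)) !)                     ≡⟨ C*!*!≡! k (k + (m + m)) ⟩
    (k + (k + (m + m))) !                            ≡⟨ cong _! (reassoc k m) ⟩
    (t + t) !                                        ∎
  rhs : ((t + t) C t) * (D * D) * (k ! * k ! * (m ! * m !)) ≡ (t + t) !
  rhs = begin
    ((t + t) C t) * (D * D) * (k ! * k ! * (m ! * m !))      ≡⟨ regroupʳ ((t + t) C t) D (k !) (k !) (m !) (m !) ⟩
    ((t + t) C t) * ((D * (k ! * m !)) * (D * (k ! * m !)))  ≡⟨ cong (λ x → ((t + t) C t) * (x * x)) (C*!*!≡! k m) ⟩
    ((t + t) C t) * (t ! * t !)                              ≡⟨ C*!*!≡! t t ⟩
    (t + t) !                                                ∎

m+m≤n+1+n⇒m≤n : ∀ m n → m + m ≤ n + suc n → m ≤ n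
m+m≤n+1+n⇒m≤n m n m+m≤n+1+n with m ≤? n
... | yes m≤n = m≤n
... | no  m≰n = contradiction (≤-trans (+-mono-≤ n<m n<m) m+m≤n+1+n) (n≮n (n + suc n))
  where
  n<m : n < m
  n<m = ≰⇒> m≰n

-- Sums over lists

⟦_⟧ : Bool → ℕ
⟦ b ⟧ = if b then 1 else 0

⟦∧⟧ : ∀ a b → ⟦ a ∧ b ⟧ ≡ ⟦ a ⟧ * ⟦ b ⟧
⟦∧⟧ true  b = sym (+-identityʳ ⟦ b ⟧)
⟦∧⟧ false b = refl

⟦∨⟧≤ : ∀ a b → ⟦ a ∨ b ⟧ ≤ ⟦ a ⟧ + ⟦ b ⟧
⟦∨⟧≤ true  b = s≤s z≤n
⟦∨⟧≤ false b = ≤-refl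

⟦∨⟧-exclusive : ∀ a b → a ∧ b ≡ false → ⟦ a ∨ b ⟧ ≡ ⟦ a ⟧ + ⟦ b ⟧
⟦∨⟧-exclusive true  false _ = refl
⟦∨⟧-exclusive false b     _ = refl

∑ : {A : Set} → List A → (A → ℕ) → ℕ
∑ []       f = 0
∑ (x ∷ xs) f = f x + ∑ xs f

syntax ∑ xs (λ x → e) = ∑[ x ∈ xs ] e

module _ {A : Set} where

  ∑-cong : ∀ (xs : List A) {f g : A → ℕ} → (∀ x → f x ≡ g x) → ∑ xs f ≡ ∑ xs g
  ∑-cong []       f≗g = refl
  ∑-cong (x ∷ xs) f≗g = cong₂ _+_ (f≗g x) (∑-cong xs f≗g)

  ∑-mono-≤ : ∀ (xs : List A) {f g : A → ℕ} → (∀ x → f x ≤ g x) → ∑ xs f ≤ ∑ xs g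
  ∑-mono-≤ []       f≤g = z≤n
  ∑-mono-≤ (x ∷ xs) f≤g = +-mono-≤ (f≤g x) (∑-mono-≤ xs f≤g)

  ∑-zero : ∀ (xs : List A) {f : A → ℕ} → (∀ x → f x ≡ 0) → ∑ xs f ≡ 0
  ∑-zero []       f≗0 = refl
  ∑-zero (x ∷ xs) f≗0 = cong₂ _+_ (f≗0 x) (∑-zero xs f≗0)

  ∑-const : ∀ (xs : List A) c → ∑[ x ∈ xs ] c ≡ length xs * c
  ∑-const []       c = refl
  ∑-const (x ∷ xs) c = cong (c +_) (∑-const xs c)

  ∑-+ : ∀ (xs : List A) (f g : A → ℕ) → ∑[ x ∈ xs ] (f x + g x) ≡ ∑ xs f + ∑ xs g
  ∑-+ []       f g = refl
  ∑-+ (x ∷ xs) f g = trans (cong (f x + g x +_) (∑-+ xs f g)) (+-interchange (f x) (g x) (∑ xs f) (∑ xs g))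

  ∑-*ˡ : ∀ (xs : List A) c (f : A → ℕ) → ∑[ x ∈ xs ] (c * f x) ≡ c * ∑ xs f
  ∑-*ˡ []       c f = sym (*-zeroʳ c)
  ∑-*ˡ (x ∷ xs) c f = trans (cong (c * f x +_) (∑-*ˡ xs c f)) (sym (*-distribˡ-+ c (f x) (∑ xs f)))

  ∑-*ʳ : ∀ (xs : List A) (f : A → ℕ) c → ∑[ x ∈ xs ] (f x * c) ≡ ∑ xs f * c
  ∑-*ʳ []       f c = refl
  ∑-*ʳ (x ∷ xs) f c = trans (cong (f x * c +_) (∑-*ʳ xs f c)) (sym (*-distribʳ-+ c (f x) (∑ xs f)))

  ∑-++ : ∀ (xs ys : List A) (f : A → ℕ) → ∑ (xs ++ ys) f ≡ ∑ xs f + ∑ ys f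
  ∑-++ []       ys f = refl
  ∑-++ (x ∷ xs) ys f = trans (cong (f x +_) (∑-++ xs ys f)) (sym (+-assoc (f x) (∑ xs f) (∑ ys f)))

∑-map : ∀ {A B : Set} (g : A → B) (xs : List A) (f : B → ℕ) → ∑ (map g xs) f ≡ ∑[ x ∈ xs ] f (g x)
∑-map g []       f = refl
∑-map g (x ∷ xs) f = cong (f (g x) +_) (∑-map g xs f)

∑-comm : ∀ {A B : Set} (xs : List A) (ys : List B) (f : A → B → ℕ) →
         ∑[ x ∈ xs ] ∑[ y ∈ ys ] f x y ≡ ∑[ y ∈ ys ] ∑[ x ∈ xs ] f x y
∑-comm []       ys f = sym (∑-zero ys (λ _ → refl))
∑-comm (x ∷ xs) ys f = trans (cong (∑ ys (f x) +_) (∑-comm xs ys f))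
                             (sym (∑-+ ys (f x) (λ y → ∑[ x ∈ xs ] f x y)))

∑∑-* : ∀ {A B : Set} (xs : List A) (ys : List B) (f : A → ℕ) (g : B → ℕ) →
       ∑[ x ∈ xs ] ∑[ y ∈ ys ] (f x * g y) ≡ ∑ xs f * ∑ ys g
∑∑-* xs ys f g = trans (∑-cong xs (λ x → ∑-*ˡ ys (f x) g)) (∑-*ʳ xs f (∑ ys g))

-- Subsets as Boolean vectors

private variable n : ℕ

-- Boolean-valued, so that indicators of these conditions compute on the heads of the vectors.
infix 7 _⊆ᵇ_

_⊆ᵇ_ : Subset n → Subset n → Bool
[]      ⊆ᵇ []      = true
(x ∷ p) ⊆ᵇ (y ∷ q) = (not x ∨ y) ∧ p ⊆ᵇ q

disjointᵇ : Subset n → Subset n → Bool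
disjointᵇ []      []      = true
disjointᵇ (x ∷ p) (y ∷ q) = not (x ∧ y) ∧ disjointᵇ p q

⊥⊆ᵇ : ∀ (p : Subset n) → ⊥ ⊆ᵇ p ≡ true
⊥⊆ᵇ []      = refl
⊥⊆ᵇ (x ∷ p) = ⊥⊆ᵇ p

⊆ᵇ⊤ : ∀ (p : Subset n) → p ⊆ᵇ ⊤ ≡ true
⊆ᵇ⊤ []          = refl
⊆ᵇ⊤ (true  ∷ p) = ⊆ᵇ⊤ p
⊆ᵇ⊤ (false ∷ p) = ⊆ᵇ⊤ p

⊆ᵇ-refl : ∀ (p : Subset n) → p ⊆ᵇ p ≡ true
⊆ᵇ-refl []          = refl
⊆ᵇ-refl (true  ∷ p) = ⊆ᵇ-refl p
⊆ᵇ-refl (false ∷ p) = ⊆ᵇ-refl p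

p⊆ᵇq⇒∣p∣≤∣q∣ : ∀ (p q : Subset n) → p ⊆ᵇ q ≡ true → ∣ p ∣ ≤ ∣ q ∣
p⊆ᵇq⇒∣p∣≤∣q∣ []          []          _   = z≤n
p⊆ᵇq⇒∣p∣≤∣q∣ (true  ∷ p) (true  ∷ q) p⊆q = s≤s (p⊆ᵇq⇒∣p∣≤∣q∣ p q p⊆q)
p⊆ᵇq⇒∣p∣≤∣q∣ (false ∷ p) (true  ∷ q) p⊆q = m≤n⇒m≤1+n (p⊆ᵇq⇒∣p∣≤∣q∣ p q p⊆q)
p⊆ᵇq⇒∣p∣≤∣q∣ (false ∷ p) (false ∷ q) p⊆q = p⊆ᵇq⇒∣p∣≤∣q∣ p q p⊆q

⊆ᵇ∁≡disjointᵇ : ∀ (p q : Subset n) → p ⊆ᵇ ∁ q ≡ disjointᵇ q p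
⊆ᵇ∁≡disjointᵇ []          []          = refl
⊆ᵇ∁≡disjointᵇ (true  ∷ p) (true  ∷ q) = refl
⊆ᵇ∁≡disjointᵇ (true  ∷ p) (false ∷ q) = ⊆ᵇ∁≡disjointᵇ p q
⊆ᵇ∁≡disjointᵇ (false ∷ p) (true  ∷ q) = ⊆ᵇ∁≡disjointᵇ p q
⊆ᵇ∁≡disjointᵇ (false ∷ p) (false ∷ q) = ⊆ᵇ∁≡disjointᵇ p q

disjointᵇ-sym : ∀ (p q : Subset n) → disjointᵇ p q ≡ disjointᵇ q p
disjointᵇ-sym []          []          = refl
disjointᵇ-sym (true  ∷ p) (true  ∷ q) = refl
disjointᵇ-sym (true  ∷ p) (false ∷ q) = disjointᵇ-sym p q
disjointᵇ-sym (false ∷ p) (true  ∷ q) = disjointᵇ-sym p q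
disjointᵇ-sym (false ∷ p) (false ∷ q) = disjointᵇ-sym p q

disjointᵇ⇒disjoint : ∀ (p q : Subset n) → disjointᵇ p q ≡ true → ∀ i → i ∈ p → i ∉ q
disjointᵇ⇒disjoint (true ∷ p) (true  ∷ q) ()  zero    here      here
disjointᵇ⇒disjoint (x    ∷ p) (y     ∷ q) p#q (suc i) (there i∈p) (there i∈q) =
  disjointᵇ⇒disjoint p q (∧-conicalʳ (not (x ∧ y)) _ p#q) i i∈p i∈q

disjoint⇒disjointᵇ : ∀ (p q : Subset n) → (∀ i → i ∈ p → i ∉ q) → disjointᵇ p q ≡ true
disjoint⇒disjointᵇ []          []          _   = refl
disjoint⇒disjointᵇ (true  ∷ p) (true  ∷ q) p#q = contradiction here (p#q zero here)
disjoint⇒disjointᵇ (true  ∷ p) (false ∷ q) p#q =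
  disjoint⇒disjointᵇ p q (λ i i∈p i∈q → p#q (suc i) (there i∈p) (there i∈q))
disjoint⇒disjointᵇ (false ∷ p) (y     ∷ q) p#q =
  disjoint⇒disjointᵇ p q (λ i i∈p i∈q → p#q (suc i) (there i∈p) (there i∈q))

⊆ᵇ⇒¬disjointᵇ : ∀ (p q : Subset n) → 0 < ∣ p ∣ → p ⊆ᵇ q ≡ true → disjointᵇ p q ≡ false
⊆ᵇ⇒¬disjointᵇ (true  ∷ p) (true  ∷ q) _   _   = refl
⊆ᵇ⇒¬disjointᵇ (false ∷ p) (y     ∷ q) 0<∣p∣ p⊆q = ⊆ᵇ⇒¬disjointᵇ p q 0<∣p∣ p⊆q

⊆ᵇ∧disjointᵇ-exclusive : ∀ (u v S : Subset n) → 0 < ∣ u ∣ →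
  (u ⊆ᵇ S ∧ disjointᵇ v S) ∧ (v ⊆ᵇ S ∧ disjointᵇ u S) ≡ false
⊆ᵇ∧disjointᵇ-exclusive u v S 0<∣u∣ with u ⊆ᵇ S in u⊆S
... | false = refl
... | true  = begin
  disjointᵇ v S ∧ (v ⊆ᵇ S ∧ disjointᵇ u S) ≡⟨ cong (λ b → disjointᵇ v S ∧ (v ⊆ᵇ S ∧ b))
                                                   (⊆ᵇ⇒¬disjointᵇ u S 0<∣u∣ u⊆S) ⟩
  disjointᵇ v S ∧ (v ⊆ᵇ S ∧ false)         ≡⟨ cong (disjointᵇ v S ∧_) (∧-zeroʳ (v ⊆ᵇ S)) ⟩
  disjointᵇ v S ∧ false                    ≡⟨ ∧-zeroʳ (disjointᵇ v S) ⟩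
  false                                    ∎
  where open ≡-Reasoning

⊆ᵇ∧disjointᵇ⇒disjointᵇ : ∀ (p q r : Subset n) → p ⊆ᵇ q ≡ true → disjointᵇ r q ≡ true → disjointᵇ p r ≡ true
⊆ᵇ∧disjointᵇ⇒disjointᵇ []          []          []          _   _   = refl
⊆ᵇ∧disjointᵇ⇒disjointᵇ (true  ∷ p) (true  ∷ q) (false ∷ r) p⊆q r#q = ⊆ᵇ∧disjointᵇ⇒disjointᵇ p q r p⊆q r#q
⊆ᵇ∧disjointᵇ⇒disjointᵇ (false ∷ p) (true  ∷ q) (false ∷ r) p⊆q r#q = ⊆ᵇ∧disjointᵇ⇒disjointᵇ p q r p⊆q r#q
⊆ᵇ∧disjointᵇ⇒disjointᵇ (false ∷ p) (false ∷ q) (true  ∷ r) p⊆q r#q = ⊆ᵇ∧disjointᵇ⇒disjointᵇ p q r p⊆q r#q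
⊆ᵇ∧disjointᵇ⇒disjointᵇ (false ∷ p) (false ∷ q) (false ∷ r) p⊆q r#q = ⊆ᵇ∧disjointᵇ⇒disjointᵇ p q r p⊆q r#q

∪-⊆ᵇ : ∀ (p q r : Subset n) → (p ∪ q) ⊆ᵇ r ≡ p ⊆ᵇ r ∧ q ⊆ᵇ r
∪-⊆ᵇ []          []          []          = refl
∪-⊆ᵇ (true  ∷ p) (y     ∷ q) (false ∷ r) = refl
∪-⊆ᵇ (false ∷ p) (true  ∷ q) (false ∷ r) = sym (∧-zeroʳ (p ⊆ᵇ r))
∪-⊆ᵇ (false ∷ p) (false ∷ q) (false ∷ r) = ∪-⊆ᵇ p q r
∪-⊆ᵇ (true  ∷ p) (true  ∷ q) (true  ∷ r) = ∪-⊆ᵇ p q r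
∪-⊆ᵇ (true  ∷ p) (false ∷ q) (true  ∷ r) = ∪-⊆ᵇ p q r
∪-⊆ᵇ (false ∷ p) (true  ∷ q) (true  ∷ r) = ∪-⊆ᵇ p q r
∪-⊆ᵇ (false ∷ p) (false ∷ q) (true  ∷ r) = ∪-⊆ᵇ p q r

p⊆ᵇ∁q⇒∣p∣+∣q∣≤n : ∀ (p q : Subset n) → p ⊆ᵇ ∁ q ≡ true → ∣ p ∣ + ∣ q ∣ ≤ n
p⊆ᵇ∁q⇒∣p∣+∣q∣≤n {n} p q p⊆∁q = begin
  ∣ p ∣ + ∣ q ∣        ≤⟨ +-monoˡ-≤ ∣ q ∣ (p⊆ᵇq⇒∣p∣≤∣q∣ p (∁ q) p⊆∁q) ⟩
  ∣ ∁ q ∣ + ∣ q ∣      ≡⟨ cong (_+ ∣ q ∣) (∣∁p∣≡n∸∣p∣ q) ⟩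
  (n ∸ ∣ q ∣) + ∣ q ∣  ≡⟨ m∸n+n≡m (∣p∣≤n q) ⟩
  n                    ∎
  where open ≤-Reasoning

-- Counting subsets

subsets : ∀ n → List (Subset n)
subsets zero    = [] ∷ []
subsets (suc n) = map (true ∷_) (subsets n) ++ map (false ∷_) (subsets n)

∑-subsets-suc : ∀ (f : Subset (suc n) → ℕ) →
  ∑ (subsets (suc n)) f ≡ ∑[ S ∈ subsets n ] f (true ∷ S) + ∑[ S ∈ subsets n ] f (false ∷ S)
∑-subsets-suc {n} f = begin
  ∑ (map (true ∷_) (subsets n) ++ map (false ∷_) (subsets n)) f
    ≡⟨ ∑-++ (map (true ∷_) (subsets n)) _ f ⟩
  ∑ (map (true ∷_) (subsets n)) f + ∑ (map (false ∷_) (subsets n)) f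
    ≡⟨ cong₂ _+_ (∑-map (true ∷_) (subsets n) f) (∑-map (false ∷_) (subsets n) f) ⟩
  ∑[ S ∈ subsets n ] f (true ∷ S) + ∑[ S ∈ subsets n ] f (false ∷ S) ∎
  where open ≡-Reasoning

subsetsOfSize : ∀ n k → List (Σ (Subset n) λ S → ∣ S ∣ ≡ k)
subsetsOfSize zero    zero    = ([] , refl) ∷ []
subsetsOfSize zero    (suc k) = []
subsetsOfSize (suc n) zero    = map (λ (S , ∣S∣≡0) → false ∷ S , ∣S∣≡0) (subsetsOfSize n zero)
subsetsOfSize (suc n) (suc k) =
  map (λ (S , ∣S∣≡k) → true ∷ S , cong suc ∣S∣≡k) (subsetsOfSize n k) ++
  map (λ (S , ∣S∣≡1+k) → false ∷ S , ∣S∣≡1+k) (subsetsOfSize n (suc k))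

∑-subsetsOfSize : ∀ n k (f : Subset n → ℕ) →
  ∑[ v ∈ subsetsOfSize n k ] f (proj₁ v) ≡ ∑[ S ∈ subsets n ] (f S * ⟦ ∣ S ∣ ≡ᵇ k ⟧)
∑-subsetsOfSize zero    zero    f = cong (_+ 0) (sym (*-identityʳ (f [])))
∑-subsetsOfSize zero    (suc k) f = cong (_+ 0) (sym (*-zeroʳ (f [])))
∑-subsetsOfSize (suc n) zero    f = begin
  ∑ (map _ (subsetsOfSize n zero)) (λ v → f (proj₁ v))
    ≡⟨ ∑-map _ (subsetsOfSize n zero) (λ v → f (proj₁ v)) ⟩
  ∑[ v ∈ subsetsOfSize n zero ] f (false ∷ proj₁ v)
    ≡⟨ ∑-subsetsOfSize n zero (λ S → f (false ∷ S)) ⟩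
  ∑[ S ∈ subsets n ] (f (false ∷ S) * ⟦ ∣ S ∣ ≡ᵇ 0 ⟧)
    ≡⟨ cong (_+ ∑[ S ∈ subsets n ] (f (false ∷ S) * ⟦ ∣ S ∣ ≡ᵇ 0 ⟧))
            (sym (∑-zero (subsets n) (λ S → *-zeroʳ (f (true ∷ S))))) ⟩
  ∑[ S ∈ subsets n ] (f (true ∷ S) * 0) + ∑[ S ∈ subsets n ] (f (false ∷ S) * ⟦ ∣ S ∣ ≡ᵇ 0 ⟧)
    ≡⟨ sym (∑-subsets-suc (λ S → f S * ⟦ ∣ S ∣ ≡ᵇ 0 ⟧)) ⟩
  ∑[ S ∈ subsets (suc n) ] (f S * ⟦ ∣ S ∣ ≡ᵇ 0 ⟧) ∎
  where open ≡-Reasoning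
∑-subsetsOfSize (suc n) (suc k) f = begin
  ∑ (map _ (subsetsOfSize n k) ++ map _ (subsetsOfSize n (suc k))) (λ v → f (proj₁ v))
    ≡⟨ ∑-++ (map _ (subsetsOfSize n k)) _ (λ v → f (proj₁ v)) ⟩
  ∑ (map _ (subsetsOfSize n k)) (λ v → f (proj₁ v)) + ∑ (map _ (subsetsOfSize n (suc k))) (λ v → f (proj₁ v))
    ≡⟨ cong₂ _+_ (∑-map _ (subsetsOfSize n k) (λ v → f (proj₁ v)))
                 (∑-map _ (subsetsOfSize n (suc k)) (λ v → f (proj₁ v))) ⟩
  ∑[ v ∈ subsetsOfSize n k ] f (true ∷ proj₁ v) + ∑[ v ∈ subsetsOfSize n (suc k) ] f (false ∷ proj₁ v)
    ≡⟨ cong₂ _+_ (∑-subsetsOfSize n k (λ S → f (true ∷ S)))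
                 (∑-subsetsOfSize n (suc k) (λ S → f (false ∷ S))) ⟩
  ∑[ S ∈ subsets n ] (f (true ∷ S) * ⟦ ∣ S ∣ ≡ᵇ k ⟧) + ∑[ S ∈ subsets n ] (f (false ∷ S) * ⟦ ∣ S ∣ ≡ᵇ suc k ⟧)
    ≡⟨ sym (∑-subsets-suc (λ S → f S * ⟦ ∣ S ∣ ≡ᵇ suc k ⟧)) ⟩
  ∑[ S ∈ subsets (suc n) ] (f S * ⟦ ∣ S ∣ ≡ᵇ suc k ⟧) ∎
  where open ≡-Reasoning

-- Such S are u together with c points of W ∖ u.
∑-subsets-between : ∀ (u W : Subset n) c → u ⊆ᵇ W ≡ true →
  ∑[ S ∈ subsets n ] (⟦ u ⊆ᵇ S ∧ S ⊆ᵇ W ⟧ * ⟦ ∣ S ∣ ≡ᵇ c + ∣ u ∣ ⟧) ≡ (∣ W ∣ ∸ ∣ u ∣) C c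
∑-subsets-between [] [] zero    _ = refl
∑-subsets-between [] [] (suc c) _ = refl
∑-subsets-between {suc n} (true ∷ u) (true ∷ W) c u⊆W = begin
  _ ≡⟨ ∑-subsets-suc (λ S → ⟦ (true ∷ u) ⊆ᵇ S ∧ S ⊆ᵇ (true ∷ W) ⟧ * ⟦ ∣ S ∣ ≡ᵇ c + suc ∣ u ∣ ⟧) ⟩
  ∑[ S ∈ subsets n ] (⟦ u ⊆ᵇ S ∧ S ⊆ᵇ W ⟧ * ⟦ suc ∣ S ∣ ≡ᵇ c + suc ∣ u ∣ ⟧) + ∑[ S ∈ subsets n ] 0
    ≡⟨ cong₂ _+_ (∑-cong (subsets n) (λ S → cong (λ m → ⟦ u ⊆ᵇ S ∧ S ⊆ᵇ W ⟧ * ⟦ suc ∣ S ∣ ≡ᵇ m ⟧)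
                                                  (+-suc c ∣ u ∣)))
                 (∑-zero (subsets n) (λ _ → refl)) ⟩
  ∑[ S ∈ subsets n ] (⟦ u ⊆ᵇ S ∧ S ⊆ᵇ W ⟧ * ⟦ ∣ S ∣ ≡ᵇ c + ∣ u ∣ ⟧) + 0
    ≡⟨ +-identityʳ _ ⟩
  ∑[ S ∈ subsets n ] (⟦ u ⊆ᵇ S ∧ S ⊆ᵇ W ⟧ * ⟦ ∣ S ∣ ≡ᵇ c + ∣ u ∣ ⟧)
    ≡⟨ ∑-subsets-between u W c u⊆W ⟩
  (∣ W ∣ ∸ ∣ u ∣) C c ∎
  where open ≡-Reasoning
∑-subsets-between {suc n} (false ∷ u) (true ∷ W) zero u⊆W =
  trans (∑-subsets-suc (λ S → ⟦ (false ∷ u) ⊆ᵇ S ∧ S ⊆ᵇ (true ∷ W) ⟧ * ⟦ ∣ S ∣ ≡ᵇ ∣ u ∣ ⟧))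
        (cong₂ _+_ (∑-zero (subsets n) too-small) (∑-subsets-between u W zero u⊆W))
  where
  too-small : ∀ S → ⟦ u ⊆ᵇ S ∧ S ⊆ᵇ W ⟧ * ⟦ suc ∣ S ∣ ≡ᵇ ∣ u ∣ ⟧ ≡ 0
  too-small S with u ⊆ᵇ S in u⊆S
  ... | false = refl
  ... | true with suc ∣ S ∣ ≡ᵇ ∣ u ∣ in eq
  ...   | false = *-zeroʳ ⟦ S ⊆ᵇ W ⟧
  ...   | true  = contradiction (p⊆ᵇq⇒∣p∣≤∣q∣ u S u⊆S) (<⇒≱ (≤-reflexive (≡ᵇ⇒≡ _ _ (subst T (sym eq) tt))))
∑-subsets-between {suc n} (false ∷ u) (true ∷ W) (suc c) u⊆W = begin
  _ ≡⟨ ∑-subsets-suc (λ S → ⟦ (false ∷ u) ⊆ᵇ S ∧ S ⊆ᵇ (true ∷ W) ⟧ * ⟦ ∣ S ∣ ≡ᵇ suc c + ∣ u ∣ ⟧) ⟩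
  ∑[ S ∈ subsets n ] (⟦ u ⊆ᵇ S ∧ S ⊆ᵇ W ⟧ * ⟦ ∣ S ∣ ≡ᵇ c + ∣ u ∣ ⟧) +
  ∑[ S ∈ subsets n ] (⟦ u ⊆ᵇ S ∧ S ⊆ᵇ W ⟧ * ⟦ ∣ S ∣ ≡ᵇ suc c + ∣ u ∣ ⟧)
    ≡⟨ cong₂ _+_ (∑-subsets-between u W c u⊆W) (∑-subsets-between u W (suc c) u⊆W) ⟩
  (∣ W ∣ ∸ ∣ u ∣) C c + (∣ W ∣ ∸ ∣ u ∣) C suc c
    ≡⟨ nCk+nC[k+1]≡[n+1]C[k+1] (∣ W ∣ ∸ ∣ u ∣) c ⟩
  suc (∣ W ∣ ∸ ∣ u ∣) C suc c
    ≡⟨ cong (_C suc c) (sym (+-∸-assoc 1 (p⊆ᵇq⇒∣p∣≤∣q∣ u W u⊆W))) ⟩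
  (suc ∣ W ∣ ∸ ∣ u ∣) C suc c ∎
  where open ≡-Reasoning
∑-subsets-between {suc n} (false ∷ u) (false ∷ W) c u⊆W =
  trans (∑-subsets-suc (λ S → ⟦ (false ∷ u) ⊆ᵇ S ∧ S ⊆ᵇ (false ∷ W) ⟧ * ⟦ ∣ S ∣ ≡ᵇ c + ∣ u ∣ ⟧))
        (cong₂ _+_ (∑-zero (subsets n) outside-W) (∑-subsets-between u W c u⊆W))
  where
  outside-W : ∀ S → ⟦ u ⊆ᵇ S ∧ false ⟧ * ⟦ suc ∣ S ∣ ≡ᵇ c + ∣ u ∣ ⟧ ≡ 0
  outside-W S = cong (λ b → ⟦ b ⟧ * ⟦ suc ∣ S ∣ ≡ᵇ c + ∣ u ∣ ⟧) (∧-zeroʳ (u ⊆ᵇ S))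

∑-subsetsOfSize-between : ∀ (u W : Subset n) c {k} → u ⊆ᵇ W ≡ true → c + ∣ u ∣ ≡ k →
  ∑[ v ∈ subsetsOfSize n k ] ⟦ u ⊆ᵇ proj₁ v ∧ proj₁ v ⊆ᵇ W ⟧ ≡ (∣ W ∣ ∸ ∣ u ∣) C c
∑-subsetsOfSize-between {n} u W c u⊆W refl =
  trans (∑-subsetsOfSize n _ (λ S → ⟦ u ⊆ᵇ S ∧ S ⊆ᵇ W ⟧)) (∑-subsets-between u W c u⊆W)

∑-subsetsOfSize-⊆ᵇ : ∀ (W : Subset n) k → ∑[ v ∈ subsetsOfSize n k ] ⟦ proj₁ v ⊆ᵇ W ⟧ ≡ ∣ W ∣ C k
∑-subsetsOfSize-⊆ᵇ {n} W k = begin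
  ∑[ v ∈ subsetsOfSize n k ] ⟦ proj₁ v ⊆ᵇ W ⟧
    ≡⟨ ∑-cong (subsetsOfSize n k) (λ v → cong (λ b → ⟦ b ∧ proj₁ v ⊆ᵇ W ⟧) (sym (⊥⊆ᵇ (proj₁ v)))) ⟩
  ∑[ v ∈ subsetsOfSize n k ] ⟦ ⊥ ⊆ᵇ proj₁ v ∧ proj₁ v ⊆ᵇ W ⟧
    ≡⟨ ∑-subsetsOfSize-between ⊥ W k (⊥⊆ᵇ W) (trans (cong (k +_) (∣⊥∣≡0 n)) (+-identityʳ k)) ⟩
  (∣ W ∣ ∸ ∣ ⊥ {n} ∣) C k
    ≡⟨ cong (λ m → (∣ W ∣ ∸ m) C k) (∣⊥∣≡0 n) ⟩
  ∣ W ∣ C k ∎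
  where open ≡-Reasoning

length-subsetsOfSize : ∀ n k → length (subsetsOfSize n k) ≡ n C k
length-subsetsOfSize n k = begin
  length (subsetsOfSize n k)                     ≡⟨ sym (*-identityʳ _) ⟩
  length (subsetsOfSize n k) * 1                 ≡⟨ sym (∑-const (subsetsOfSize n k) 1) ⟩
  ∑[ v ∈ subsetsOfSize n k ] 1                   ≡⟨ ∑-cong (subsetsOfSize n k) (λ v → cong ⟦_⟧ (sym (⊆ᵇ⊤ (proj₁ v)))) ⟩
  ∑[ v ∈ subsetsOfSize n k ] ⟦ proj₁ v ⊆ᵇ ⊤ ⟧    ≡⟨ ∑-subsetsOfSize-⊆ᵇ {n} ⊤ k ⟩
  ∣ ⊤ {n} ∣ C k                                  ≡⟨ cong (_C k) (∣⊤∣≡n n) ⟩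
  n C k                                          ∎
  where open ≡-Reasoning

⊆ᵇ-ofSize : ∀ (S : Subset n) k → k ≤ ∣ S ∣ → Σ (Subset n) λ a → ∣ a ∣ ≡ k × a ⊆ᵇ S ≡ true
⊆ᵇ-ofSize {n} S zero _ = ⊥ , ∣⊥∣≡0 n , ⊥⊆ᵇ S
⊆ᵇ-ofSize (true ∷ S) (suc k) (s≤s k≤∣S∣) =
  let (a , ∣a∣≡k , a⊆S) = ⊆ᵇ-ofSize S k k≤∣S∣ in true ∷ a , cong suc ∣a∣≡k , a⊆S
⊆ᵇ-ofSize (false ∷ S) (suc k) k≤∣S∣ =
  let (a , ∣a∣≡k , a⊆S) = ⊆ᵇ-ofSize S (suc k) k≤∣S∣ in false ∷ a , ∣a∣≡k , a⊆S

-- The lower bound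

mult≡∑ : ∀ {G} (F : List (Biclique G)) u v → mult F u v ≡ ∑[ β ∈ F ] ⟦ contains β u v ⟧
mult≡∑ []      u v = refl
mult≡∑ (β ∷ F) u v = cong (⟦ contains β u v ⟧ +_) (mult≡∑ F u v)

module _ {n k : ℕ} where

  support : (V (KG n k) → Bool) → List (V (KG n k)) → Subset n
  support P []       = ⊥
  support P (v ∷ vs) = if P v then proj₁ v ∪ support P vs else support P vs

  support-⊆ᵇ : ∀ P X (vs : List (V (KG n k))) → (∀ v → P v ≡ true → proj₁ v ⊆ᵇ X ≡ true) →
               support P vs ⊆ᵇ X ≡ true
  support-⊆ᵇ P X []       _ = ⊥⊆ᵇ X
  support-⊆ᵇ P X (v ∷ vs) h with P v in Pv
  ... | false = support-⊆ᵇ P X vs h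
  ... | true  = begin
    (proj₁ v ∪ support P vs) ⊆ᵇ X        ≡⟨ ∪-⊆ᵇ (proj₁ v) (support P vs) X ⟩
    proj₁ v ⊆ᵇ X ∧ support P vs ⊆ᵇ X     ≡⟨ cong₂ _∧_ (h v Pv) (support-⊆ᵇ P X vs h) ⟩
    true                                 ∎
    where open ≡-Reasoning

  ∑-⟦⟧≤∑-⊆ᵇ : ∀ P X (vs : List (V (KG n k))) → support P vs ⊆ᵇ X ≡ true →
              ∑[ v ∈ vs ] ⟦ P v ⟧ ≤ ∑[ v ∈ vs ] ⟦ proj₁ v ⊆ᵇ X ⟧
  ∑-⟦⟧≤∑-⊆ᵇ P X []       _ = z≤n
  ∑-⟦⟧≤∑-⊆ᵇ P X (v ∷ vs) h with P v
  ... | false = +-mono-≤ z≤n (∑-⟦⟧≤∑-⊆ᵇ P X vs h)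
  ... | true  = +-mono-≤ (≤-reflexive (cong ⟦_⟧ (sym v⊆X))) (∑-⟦⟧≤∑-⊆ᵇ P X vs support⊆X)
    where
    both : proj₁ v ⊆ᵇ X ∧ support P vs ⊆ᵇ X ≡ true
    both = trans (sym (∪-⊆ᵇ (proj₁ v) (support P vs) X)) h
    v⊆X : proj₁ v ⊆ᵇ X ≡ true
    v⊆X = ∧-conicalˡ (proj₁ v ⊆ᵇ X) _ both
    support⊆X : support P vs ⊆ᵇ X ≡ true
    support⊆X = ∧-conicalʳ (proj₁ v ⊆ᵇ X) _ both

  vertices : List (V (KG n k))
  vertices = subsetsOfSize n k

  ∑-⟦⟧≤C : ∀ P → ∑[ v ∈ vertices ] ⟦ P v ⟧ ≤ ∣ support P vertices ∣ C k
  ∑-⟦⟧≤C P = begin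
    ∑[ v ∈ vertices ] ⟦ P v ⟧                          ≤⟨ ∑-⟦⟧≤∑-⊆ᵇ P X vertices (⊆ᵇ-refl X) ⟩
    ∑[ v ∈ vertices ] ⟦ proj₁ v ⊆ᵇ X ⟧                 ≡⟨ ∑-subsetsOfSize-⊆ᵇ X k ⟩
    ∣ X ∣ C k                                          ∎
    where
    open ≤-Reasoning
    X : Subset n
    X = support P vertices

  ∣support-A∣+∣support-B∣≤n : (β : Biclique (KG n k)) → ∣ support (A β) vertices ∣ + ∣ support (B β) vertices ∣ ≤ n
  ∣support-A∣+∣support-B∣≤n β = p⊆ᵇ∁q⇒∣p∣+∣q∣≤n X Y (support-⊆ᵇ (A β) (∁ Y) vertices a⊆∁Y)
    where
    X Y : Subset n
    X = support (A β) vertices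
    Y = support (B β) vertices
    a⊆∁Y : ∀ a → A β a ≡ true → proj₁ a ⊆ᵇ ∁ Y ≡ true
    a⊆∁Y a Aa = begin
      proj₁ a ⊆ᵇ ∁ Y       ≡⟨ ⊆ᵇ∁≡disjointᵇ (proj₁ a) Y ⟩
      disjointᵇ Y (proj₁ a) ≡⟨ disjointᵇ-sym Y (proj₁ a) ⟩
      disjointᵇ (proj₁ a) Y ≡⟨ sym (⊆ᵇ∁≡disjointᵇ Y (proj₁ a)) ⟩
      Y ⊆ᵇ ∁ (proj₁ a)     ≡⟨ support-⊆ᵇ (B β) (∁ (proj₁ a)) vertices b⊆∁a ⟩
      true                 ∎
      where
      open ≡-Reasoning
      b⊆∁a : ∀ b → B β b ≡ true → proj₁ b ⊆ᵇ ∁ (proj₁ a) ≡ true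
      b⊆∁a b Bb = trans (⊆ᵇ∁≡disjointᵇ (proj₁ b) (proj₁ a))
                        (disjoint⇒disjointᵇ (proj₁ a) (proj₁ b) (complete β a b Aa Bb))

  ∑∑-contains≤ : ∀ t → n ≤ t + t → (β : Biclique (KG n k)) →
    ∑[ a ∈ vertices ] ∑[ b ∈ vertices ] ⟦ contains β a b ⟧ ≤ 2 * ((t C k) * (t C k))
  ∑∑-contains≤ t n≤2t β = begin
    ∑[ a ∈ vertices ] ∑[ b ∈ vertices ] ⟦ contains β a b ⟧
      ≤⟨ ∑-mono-≤ vertices (λ a → ∑-mono-≤ vertices (λ b → pair≤ a b)) ⟩
    ∑[ a ∈ vertices ] ∑[ b ∈ vertices ] (⟦ A β a ⟧ * ⟦ B β b ⟧ + ⟦ B β a ⟧ * ⟦ A β b ⟧)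
      ≡⟨ ∑-cong vertices (λ a → ∑-+ vertices (λ b → ⟦ A β a ⟧ * ⟦ B β b ⟧) (λ b → ⟦ B β a ⟧ * ⟦ A β b ⟧)) ⟩
    ∑[ a ∈ vertices ] (∑[ b ∈ vertices ] (⟦ A β a ⟧ * ⟦ B β b ⟧) + ∑[ b ∈ vertices ] (⟦ B β a ⟧ * ⟦ A β b ⟧))
      ≡⟨ ∑-+ vertices _ _ ⟩
    ∑[ a ∈ vertices ] ∑[ b ∈ vertices ] (⟦ A β a ⟧ * ⟦ B β b ⟧) +
    ∑[ a ∈ vertices ] ∑[ b ∈ vertices ] (⟦ B β a ⟧ * ⟦ A β b ⟧)
      ≡⟨ cong₂ _+_ (∑∑-* vertices vertices (λ a → ⟦ A β a ⟧) (λ b → ⟦ B β b ⟧))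
                   (∑∑-* vertices vertices (λ a → ⟦ B β a ⟧) (λ b → ⟦ A β b ⟧)) ⟩
    ∣A∣ * ∣B∣ + ∣B∣ * ∣A∣
      ≡⟨ cong (∣A∣ * ∣B∣ +_) (trans (*-comm ∣B∣ ∣A∣) (sym (+-identityʳ (∣A∣ * ∣B∣)))) ⟩
    2 * (∣A∣ * ∣B∣)
      ≤⟨ *-monoʳ-≤ 2 (*-mono-≤ (∑-⟦⟧≤C (A β)) (∑-⟦⟧≤C (B β))) ⟩
    2 * ((∣ X ∣ C k) * (∣ Y ∣ C k))
      ≤⟨ *-monoʳ-≤ 2 (xCk*yCk≤tCk*tCk t k ∣ X ∣ ∣ Y ∣ (≤-trans (∣support-A∣+∣support-B∣≤n β) n≤2t)) ⟩
    2 * ((t C k) * (t C k)) ∎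
    where
    open ≤-Reasoning
    X Y : Subset n
    X = support (A β) vertices
    Y = support (B β) vertices
    ∣A∣ ∣B∣ : ℕ
    ∣A∣ = ∑[ v ∈ vertices ] ⟦ A β v ⟧
    ∣B∣ = ∑[ v ∈ vertices ] ⟦ B β v ⟧
    pair≤ : ∀ a b → ⟦ contains β a b ⟧ ≤ ⟦ A β a ⟧ * ⟦ B β b ⟧ + ⟦ B β a ⟧ * ⟦ A β b ⟧
    pair≤ a b = begin
      ⟦ (A β a ∧ B β b) ∨ (A β b ∧ B β a) ⟧     ≤⟨ ⟦∨⟧≤ (A β a ∧ B β b) (A β b ∧ B β a) ⟩
      ⟦ A β a ∧ B β b ⟧ + ⟦ A β b ∧ B β a ⟧     ≡⟨ cong₂ _+_ (⟦∧⟧ (A β a) (B β b))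
                                                       (trans (⟦∧⟧ (A β b) (B β a)) (*-comm ⟦ A β b ⟧ ⟦ B β a ⟧)) ⟩
      ⟦ A β a ⟧ * ⟦ B β b ⟧ + ⟦ B β a ⟧ * ⟦ A β b ⟧ ∎

  ∑∑-disjoint : ∑[ a ∈ vertices ] ∑[ b ∈ vertices ] ⟦ disjointᵇ (proj₁ a) (proj₁ b) ⟧ ≡ (n C k) * ((n ∸ k) C k)
  ∑∑-disjoint = begin
    ∑[ a ∈ vertices ] ∑[ b ∈ vertices ] ⟦ disjointᵇ (proj₁ a) (proj₁ b) ⟧ ≡⟨ ∑-cong vertices neighbours ⟩
    ∑[ a ∈ vertices ] ((n ∸ k) C k)                                      ≡⟨ ∑-const vertices ((n ∸ k) C k) ⟩
    length vertices * ((n ∸ k) C k)                                      ≡⟨ cong (_* ((n ∸ k) C k)) (length-subsetsOfSize n k) ⟩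
    (n C k) * ((n ∸ k) C k)                                              ∎
    where
    open ≡-Reasoning
    neighbours : ∀ a → ∑[ b ∈ vertices ] ⟦ disjointᵇ (proj₁ a) (proj₁ b) ⟧ ≡ (n ∸ k) C k
    neighbours (a , ∣a∣≡k) = begin
      ∑[ b ∈ vertices ] ⟦ disjointᵇ a (proj₁ b) ⟧ ≡⟨ ∑-cong vertices (λ (b , _) → cong ⟦_⟧ (sym (⊆ᵇ∁≡disjointᵇ b a))) ⟩
      ∑[ b ∈ vertices ] ⟦ proj₁ b ⊆ᵇ ∁ a ⟧         ≡⟨ ∑-subsetsOfSize-⊆ᵇ (∁ a) k ⟩
      ∣ ∁ a ∣ C k                                 ≡⟨ cong (_C k) (trans (∣∁p∣≡n∸∣p∣ a) (cong (n ∸_) ∣a∣≡k)) ⟩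
      (n ∸ k) C k                                 ∎

  cover-bound : ∀ t d (F : List (Biclique (KG n k))) → n ≤ t + t → IsBicliqueCover (KG n k) d F →
    (n C k) * ((n ∸ k) C k) * d ≤ length F * (2 * ((t C k) * (t C k)))
  cover-bound t d F n≤2t cover = begin
    (n C k) * ((n ∸ k) C k) * d
      ≡⟨ cong (_* d) (sym ∑∑-disjoint) ⟩
    (∑[ a ∈ vertices ] ∑[ b ∈ vertices ] ⟦ disjointᵇ (proj₁ a) (proj₁ b) ⟧) * d
      ≡⟨ sym (trans (∑-cong vertices (λ a → ∑-*ʳ vertices _ d)) (∑-*ʳ vertices _ d)) ⟩
    ∑[ a ∈ vertices ] ∑[ b ∈ vertices ] (⟦ disjointᵇ (proj₁ a) (proj₁ b) ⟧ * d)
      ≤⟨ ∑-mono-≤ vertices (λ a → ∑-mono-≤ vertices (λ b → covered a b)) ⟩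
    ∑[ a ∈ vertices ] ∑[ b ∈ vertices ] mult F a b
      ≡⟨ ∑-cong vertices (λ a → trans (∑-cong vertices (mult≡∑ F a))
                                      (∑-comm vertices F (λ b β → ⟦ contains β a b ⟧))) ⟩
    ∑[ a ∈ vertices ] ∑[ β ∈ F ] ∑[ b ∈ vertices ] ⟦ contains β a b ⟧
      ≡⟨ ∑-comm vertices F (λ a β → ∑[ b ∈ vertices ] ⟦ contains β a b ⟧) ⟩
    ∑[ β ∈ F ] ∑[ a ∈ vertices ] ∑[ b ∈ vertices ] ⟦ contains β a b ⟧
      ≤⟨ ∑-mono-≤ F (∑∑-contains≤ t n≤2t) ⟩
    ∑[ β ∈ F ] (2 * ((t C k) * (t C k)))
      ≡⟨ ∑-const F _ ⟩
    length F * (2 * ((t C k) * (t C k))) ∎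
    where
    open ≤-Reasoning
    covered : ∀ a b → ⟦ disjointᵇ (proj₁ a) (proj₁ b) ⟧ * d ≤ mult F a b
    covered a b with disjointᵇ (proj₁ a) (proj₁ b) in a#b
    ... | false = z≤n
    ... | true  = ≤-trans (≤-reflexive (+-identityʳ d)) (cover a b (disjointᵇ⇒disjoint (proj₁ a) (proj₁ b) a#b))

cover-length : ∀ k g (F : List (Biclique (KG ((k + g) + (k + g)) k))) →
  IsBicliqueCover (KG ((k + g) + (k + g)) k) ((g + g) C g) F → ((k + g) + (k + g)) C (k + g) ≤ 2 * length F
cover-length k g F cover = *-cancelʳ-≤ _ _ ((t C k) * (t C k)) {{ C*C≢0 }} (begin
  ((t + t) C t) * ((t C k) * (t C k))                              ≡⟨ sym (C-multinomial k g) ⟩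
  ((k + (k + (g + g))) C k) * ((k + (g + g)) C k) * ((g + g) C g)  ≡⟨ cong₂ (λ x y → (x C k) * (y C k) * ((g + g) C g))
                                                                            (sym 2t≡) (sym 2t-k≡) ⟩
  ((t + t) C k) * (((t + t) ∸ k) C k) * ((g + g) C g)              ≤⟨ cover-bound t ((g + g) C g) F ≤-refl cover ⟩
  length F * (2 * ((t C k) * (t C k)))                             ≡⟨ sym (*-assoc (length F) 2 _) ⟩
  length F * 2 * ((t C k) * (t C k))                               ≡⟨ cong (_* ((t C k) * (t C k))) (*-comm (length F) 2) ⟩
  2 * length F * ((t C k) * (t C k))                               ∎)
  where
  open ≤-Reasoning
  t : ℕ
  t = k + g
  C*C≢0 : NonZero ((t C k) * (t C k))
  C*C≢0 = >-nonZero (*-mono-< (C-pos k g) (C-pos k g))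
  reassoc : ∀ k g → (k + g) + (k + g) ≡ k + (k + (g + g))
  reassoc = solve-∀
  2t≡ : t + t ≡ k + (k + (g + g))
  2t≡ = reassoc k g
  2t-k≡ : (t + t) ∸ k ≡ k + (g + g)
  2t-k≡ = trans (cong (_∸ k) 2t≡) (m+n∸m≡n k (k + (g + g)))

-- The construction

contains-sym : ∀ {G} (β : Biclique G) u v → contains β u v ≡ contains β v u
contains-sym β u v = ∨-comm (A β u ∧ B β v) (A β v ∧ B β u)

mult-sym : ∀ {G} (F : List (Biclique G)) u v → mult F u v ≡ mult F v u
mult-sym []      u v = refl
mult-sym (β ∷ F) u v = cong₂ (λ b m → ⟦ b ⟧ + m) (contains-sym β u v) (mult-sym F u v)

-- t + t reduces to suc N, so a vertex is a bit for the point 0 followed by a subset of Fin N.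
module Splitting (k′ g : ℕ) where

  k t N : ℕ
  k = suc k′
  t = suc (k′ + g)
  N = k′ + g + suc (k′ + g)

  ∣∁[0∷S]∣ : ∀ (S : Subset N) → ∣ S ∣ ≡ k′ + g → ∣ ∁ (true ∷ S) ∣ ≡ t
  ∣∁[0∷S]∣ S ∣S∣≡t-1 = trans (∣∁p∣≡n∸∣p∣ S) (trans (cong (N ∸_) ∣S∣≡t-1) (m+n∸m≡n (k′ + g) t))

  biclique : Σ (Subset N) (λ S → ∣ S ∣ ≡ k′ + g) → Biclique (KG (t + t) k)
  biclique (S′ , ∣S′∣≡t-1) = record
    { A          = λ v → proj₁ v ⊆ᵇ S
    ; B          = λ v → disjointᵇ (proj₁ v) S
    ; A-nonempty =
        let (a , ∣a∣≡k , a⊆S) = ⊆ᵇ-ofSize S k (subst (k ≤_) (cong suc (sym ∣S′∣≡t-1)) k≤t)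
        in (a , ∣a∣≡k) , a⊆S
    ; B-nonempty =
        let (b , ∣b∣≡k , b⊆∁S) = ⊆ᵇ-ofSize (∁ S) k (subst (k ≤_) (sym (∣∁[0∷S]∣ S′ ∣S′∣≡t-1)) k≤t)
        in (b , ∣b∣≡k) , trans (disjointᵇ-sym b S) (trans (sym (⊆ᵇ∁≡disjointᵇ b S)) b⊆∁S)
    ; disjoint   = λ (v , ∣v∣≡k) → ⊆ᵇ⇒¬disjointᵇ v S (subst (0 <_) (sym ∣v∣≡k) z<s)
    ; complete   = λ a b a⊆S b#S →
        disjointᵇ⇒disjoint (proj₁ a) (proj₁ b) (⊆ᵇ∧disjointᵇ⇒disjointᵇ (proj₁ a) S (proj₁ b) a⊆S b#S)
    }
    where
    S : Subset (suc N)
    S = true ∷ S′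
    k≤t : k ≤ t
    k≤t = s≤s (m≤m+n k′ g)

  family : List (Biclique (KG (t + t) k))
  family = map biclique (subsetsOfSize N (k′ + g))

  length-family : 2 * length family ≡ (t + t) C t
  length-family = begin
    2 * length family                 ≡⟨ cong (2 *_) (length-map biclique (subsetsOfSize N (k′ + g))) ⟩
    2 * length (subsetsOfSize N (k′ + g)) ≡⟨ cong (2 *_) (length-subsetsOfSize N (k′ + g)) ⟩
    2 * (N C (k′ + g))                ≡⟨ sym ([2m+2]C[m+1]≡2*[2m+1]Cm (k′ + g)) ⟩
    (t + t) C t                       ∎
    where open ≡-Reasoning

  separates : Subset N → Subset N → Σ (Subset N) (λ S → ∣ S ∣ ≡ k′ + g) → Bool
  separates u v (S , _) = u ⊆ᵇ S ∧ disjointᵇ v S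

  ∑-separates : ∀ (u v : Subset N) c → disjointᵇ u v ≡ true → c + ∣ u ∣ ≡ k′ + g →
    ∑[ S ∈ subsetsOfSize N (k′ + g) ] ⟦ separates u v S ⟧ ≡ (∣ ∁ v ∣ ∸ ∣ u ∣) C c
  ∑-separates u v c u#v size = begin
    ∑[ S ∈ subsetsOfSize N (k′ + g) ] ⟦ separates u v S ⟧
      ≡⟨ ∑-cong (subsetsOfSize N (k′ + g)) (λ (S , _) → cong (λ b → ⟦ u ⊆ᵇ S ∧ b ⟧) (sym (⊆ᵇ∁≡disjointᵇ S v))) ⟩
    ∑[ S ∈ subsetsOfSize N (k′ + g) ] ⟦ u ⊆ᵇ proj₁ S ∧ proj₁ S ⊆ᵇ ∁ v ⟧
      ≡⟨ ∑-subsetsOfSize-between u (∁ v) c u⊆∁v size ⟩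
    (∣ ∁ v ∣ ∸ ∣ u ∣) C c ∎
    where
    open ≡-Reasoning
    u⊆∁v : u ⊆ᵇ ∁ v ≡ true
    u⊆∁v = trans (⊆ᵇ∁≡disjointᵇ u v) (trans (disjointᵇ-sym v u) u#v)

  d : ℕ
  d = (g + g) C g

  mult-family : ∀ u v → mult family u v ≡ ∑[ S ∈ subsetsOfSize N (k′ + g) ] ⟦ contains (biclique S) u v ⟧
  mult-family u v = trans (mult≡∑ family u v) (∑-map biclique (subsetsOfSize N (k′ + g)) (λ β → ⟦ contains β u v ⟧))

  covers-0∪u-v : ∀ (u v : Subset N) (∣0∪u∣≡k : ∣ true ∷ u ∣ ≡ k) (∣v∣≡k : ∣ v ∣ ≡ k) → disjointᵇ u v ≡ true →
    mult family (true ∷ u , ∣0∪u∣≡k) (false ∷ v , ∣v∣≡k) ≡ d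
  covers-0∪u-v u v ∣0∪u∣≡k ∣v∣≡k u#v = begin
    mult family (true ∷ u , ∣0∪u∣≡k) (false ∷ v , ∣v∣≡k)
      ≡⟨ mult-family _ _ ⟩
    ∑[ S ∈ subsetsOfSize N (k′ + g) ] ⟦ (u ⊆ᵇ proj₁ S ∧ disjointᵇ v (proj₁ S)) ∨ (v ⊆ᵇ proj₁ S ∧ false) ⟧
      ≡⟨ ∑-cong (subsetsOfSize N (k′ + g)) (λ (S , _) → cong ⟦_⟧ (only-first S)) ⟩
    ∑[ S ∈ subsetsOfSize N (k′ + g) ] ⟦ separates u v S ⟧
      ≡⟨ ∑-separates u v g u#v (trans (cong (g +_) ∣u∣≡k-1) (+-comm g k′)) ⟩
    (∣ ∁ v ∣ ∸ ∣ u ∣) C g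
      ≡⟨ cong₂ (λ x y → (x ∸ y) C g) (trans (∣∁p∣≡n∸∣p∣ v) (cong (N ∸_) ∣v∣≡k)) ∣u∣≡k-1 ⟩
    (N ∸ k ∸ k′) C g
      ≡⟨ cong (_C g) (trans (∸-+-assoc N k k′) (trans (cong (_∸ (k + k′)) N≡) (m+n∸m≡n (k + k′) (g + g)))) ⟩
    d ∎
    where
    open ≡-Reasoning
    ∣u∣≡k-1 : ∣ u ∣ ≡ k′
    ∣u∣≡k-1 = suc-injective ∣0∪u∣≡k
    only-first : ∀ S → (u ⊆ᵇ S ∧ disjointᵇ v S) ∨ (v ⊆ᵇ S ∧ false) ≡ u ⊆ᵇ S ∧ disjointᵇ v S
    only-first S = trans (cong ((u ⊆ᵇ S ∧ disjointᵇ v S) ∨_) (∧-zeroʳ (v ⊆ᵇ S))) (∨-identityʳ _)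
    N≡ : N ≡ (k + k′) + (g + g)
    N≡ = lemma k′ g
      where
      lemma : ∀ k′ g → k′ + g + suc (k′ + g) ≡ (suc k′ + k′) + (g + g)
      lemma = solve-∀

  covers-u-v : ∀ (u v : Subset N) (∣u∣≡k : ∣ u ∣ ≡ k) (∣v∣≡k : ∣ v ∣ ≡ k) → disjointᵇ u v ≡ true →
    mult family (false ∷ u , ∣u∣≡k) (false ∷ v , ∣v∣≡k) ≡ d
  covers-u-v u v ∣u∣≡k ∣v∣≡k u#v = count (m≤n⇒∃[o]m+o≡n k≤k′+g)
    where
    k≤k′+g : k ≤ k′ + g
    k≤k′+g = m+m≤n+1+n⇒m≤n k (k′ + g)
      (subst₂ (λ x y → x + y ≤ N) ∣u∣≡k ∣v∣≡k
        (p⊆ᵇ∁q⇒∣p∣+∣q∣≤n u v (trans (⊆ᵇ∁≡disjointᵇ u v) (trans (disjointᵇ-sym v u) u#v))))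
    count : Σ ℕ (λ c → k + c ≡ k′ + g) → mult family (false ∷ u , ∣u∣≡k) (false ∷ v , ∣v∣≡k) ≡ d
    count (c , k+c≡k′+g) = begin
      mult family (false ∷ u , ∣u∣≡k) (false ∷ v , ∣v∣≡k)
        ≡⟨ mult-family _ _ ⟩
      ∑[ S ∈ Ss ] ⟦ separates u v S ∨ separates v u S ⟧
        ≡⟨ ∑-cong Ss (λ S → ⟦∨⟧-exclusive (separates u v S) (separates v u S)
                                           (⊆ᵇ∧disjointᵇ-exclusive u v (proj₁ S) 0<∣u∣)) ⟩
      ∑[ S ∈ Ss ] (⟦ separates u v S ⟧ + ⟦ separates v u S ⟧)
        ≡⟨ ∑-+ Ss (λ S → ⟦ separates u v S ⟧) (λ S → ⟦ separates v u S ⟧) ⟩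
      ∑[ S ∈ Ss ] ⟦ separates u v S ⟧ + ∑[ S ∈ Ss ] ⟦ separates v u S ⟧
        ≡⟨ cong₂ _+_ (∑-separates u v c u#v (size u ∣u∣≡k))
                     (∑-separates v u c (trans (disjointᵇ-sym v u) u#v) (size v ∣v∣≡k)) ⟩
      (∣ ∁ v ∣ ∸ ∣ u ∣) C c + (∣ ∁ u ∣ ∸ ∣ v ∣) C c
        ≡⟨ cong₂ (λ x y → x C c + y C c) (rest u v ∣u∣≡k ∣v∣≡k) (rest v u ∣v∣≡k ∣u∣≡k) ⟩
      (c + suc c) C c + (c + suc c) C c
        ≡⟨ cong ((c + suc c) C c +_) (sym (+-identityʳ _)) ⟩
      2 * ((c + suc c) C c)
        ≡⟨ sym ([2m+2]C[m+1]≡2*[2m+1]Cm c) ⟩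
      (suc c + suc c) C suc c
        ≡⟨ cong (λ x → (x + x) C x) (sym g≡1+c) ⟩
      d ∎
      where
      open ≡-Reasoning
      Ss : List (Σ (Subset N) λ S → ∣ S ∣ ≡ k′ + g)
      Ss = subsetsOfSize N (k′ + g)
      0<∣u∣ : 0 < ∣ u ∣
      0<∣u∣ = subst (0 <_) (sym ∣u∣≡k) z<s
      g≡1+c : g ≡ suc c
      g≡1+c = +-cancelˡ-≡ k′ g (suc c) (trans (sym k+c≡k′+g) (sym (+-suc k′ c)))
      size : ∀ (w : Subset N) → ∣ w ∣ ≡ k → c + ∣ w ∣ ≡ k′ + g
      size w ∣w∣≡k = trans (cong (c +_) ∣w∣≡k) (trans (+-comm c k) k+c≡k′+g)
      N≡ : N ≡ (k + k) + (c + suc c)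
      N≡ = trans (cong (λ x → x + suc x) (sym k+c≡k′+g)) (lemma k c)
        where
        lemma : ∀ k c → k + c + suc (k + c) ≡ (k + k) + (c + suc c)
        lemma = solve-∀
      rest : ∀ (w w′ : Subset N) → ∣ w ∣ ≡ k → ∣ w′ ∣ ≡ k → ∣ ∁ w′ ∣ ∸ ∣ w ∣ ≡ c + suc c
      rest w w′ ∣w∣≡k ∣w′∣≡k = begin
        ∣ ∁ w′ ∣ ∸ ∣ w ∣ ≡⟨ cong₂ _∸_ (trans (∣∁p∣≡n∸∣p∣ w′) (cong (N ∸_) ∣w′∣≡k)) ∣w∣≡k ⟩
        N ∸ k ∸ k       ≡⟨ ∸-+-assoc N k k ⟩
        N ∸ (k + k)     ≡⟨ cong (_∸ (k + k)) N≡ ⟩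
        (k + k) + (c + suc c) ∸ (k + k) ≡⟨ m+n∸m≡n (k + k) (c + suc c) ⟩
        c + suc c       ∎

  partition : IsBicliquePartition (KG (t + t) k) d family
  partition (true  ∷ u , ∣u∣) (true  ∷ v , ∣v∣) adj = contradiction here (adj zero here)
  partition (true  ∷ u , ∣u∣) (false ∷ v , ∣v∣) adj =
    covers-0∪u-v u v ∣u∣ ∣v∣ (disjoint⇒disjointᵇ (true ∷ u) (false ∷ v) adj)
  partition (false ∷ u , ∣u∣) (true  ∷ v , ∣v∣) adj =
    trans (mult-sym family _ _)
          (covers-0∪u-v v u ∣v∣ ∣u∣ (disjoint⇒disjointᵇ (true ∷ v) (false ∷ u) (λ i i∈v i∈u → adj i i∈u i∈v)))
  partition (false ∷ u , ∣u∣) (false ∷ v , ∣v∣) adj =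
    covers-u-v u v ∣u∣ ∣v∣ (disjoint⇒disjointᵇ (false ∷ u) (false ∷ v) adj)

partition⇒cover : ∀ {G d} (F : List (Biclique G)) → IsBicliquePartition G d F → IsBicliqueCover G d F
partition⇒cover F partition u v adj = ≤-reflexive (sym (partition u v adj))

optimal-partition : ∀ {G d} (F₀ : List (Biclique G)) → IsBicliquePartition G d F₀ →
  (∀ F → IsBicliqueCover G d F → length F₀ ≤ length F) → bc-is G d (length F₀) × bp-is G d (length F₀)
optimal-partition F₀ partition minimal =
  ((F₀ , partition⇒cover F₀ partition , refl) , minimal) ,
  ((F₀ , partition , refl) , λ F partition′ → minimal F (partition⇒cover F partition′))

d≡[g+g]Cg : ∀ k g → (2 * (k + g) ∸ 2 * k) C ((k + g) ∸ k) ≡ (g + g) C g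
d≡[g+g]Cg k g = cong₂ _C_ (trans (cong (_∸ 2 * k) (expand k g)) (m+n∸m≡n (2 * k) (g + g))) (m+n∸m≡n k g)
  where
  expand : ∀ k g → 2 * (k + g) ≡ 2 * k + (g + g)
  expand = solve-∀

2*x≡m⇒m/2≡x : ∀ {m x} → 2 * x ≡ m → m / 2 ≡ x
2*x≡m⇒m/2≡x {x = x} refl = trans (cong (_/ 2) (*-comm 2 x)) (m*n/n≡m x 2)

2*n≡n+n : ∀ n → 2 * n ≡ n + n
2*n≡n+n n = cong (n +_) (+-identityʳ n)

theorem2p3 : (k t : ℕ) → 1 ≤ k → k ≤ t →
    bc-is (KG (2 * t) k) ((2 * t ∸ 2 * k) C (t ∸ k)) (((2 * t) C t) / 2) ×
    bp-is (KG (2 * t) k) ((2 * t ∸ 2 * k) C (t ∸ k)) (((2 * t) C t) / 2)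
theorem2p3 (suc k′) t _ k≤t with m≤n⇒∃[o]m+o≡n k≤t
... | g , refl =
  subst₂ (λ d m → bc-is (KG (2 * t) k) d m × bp-is (KG (2 * t) k) d m) (sym (d≡[g+g]Cg k g)) (sym half-central)
    (subst (λ n → bc-is (KG n k) d m × bp-is (KG n k) d m) (sym (2*n≡n+n t))
      (optimal-partition family partition minimal))
  where
  open Splitting k′ g using (k; d; family; length-family; partition)
  m : ℕ
  m = length family
  half-central : ((2 * t) C t) / 2 ≡ length family
  half-central = 2*x≡m⇒m/2≡x (trans length-family (cong (_C t) (sym (2*n≡n+n t))))
  minimal : ∀ F → IsBicliqueCover (KG (t + t) k) d F → length family ≤ length F
  minimal F cover = *-cancelˡ-≤ 2 (subst (_≤ 2 * length F) (sym length-family) (cover-length k g F cover))
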